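{- Let $q=p^n$ be a power of an odd prime $p\ne 3$ with $q\equiv 3\pmod 4$, and $F=F_{2,\frac13}(x)=x^2\big(1+\frac13\eta(x)\big)$. For any $b\in\mathbb{F}_q$, $\#A_{00}(b)$ and $\#A_{01}(b)$ cannot both be nonzero.
   Context: $\eta$ is the quadratic character of $\mathbb{F}_q$ ($\eta(0)=0$, $\eta=1$ on nonzero squares, $-1$ on non-squares). $C_{00}=\{x:\eta(x)=\eta(x+1)=1\}$, $C_{01}=\{x:\eta(x)=1,\eta(x+1)=-1\}$, and $A_{ij}(b)=\{x\in C_{ij}: F(x+1)-F(x)=b\}$. -}

module Defs where

open import Level using (0ℓ)
open import Data.Nat as ℕ using (ℕ; zero; suc)
open import Data.Fin using (Fin)
open import Data.Fin.Properties using (any?)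
open import Data.Product using (Σ; ∃; _×_; _,_)
open import Function.Bundles using (_↔_; Inverse)
open import Relation.Nullary using (¬_; Dec; yes; no)
open import Relation.Binary.PropositionalEquality using (_≡_; _≢_)
open import Algebra.Structures using (IsCommutativeRing)

-- The inverse is a total
-- function (convention 0⁻¹ arbitrary); it is a genuine inverse on nonzero
-- elements.
record FiniteField : Set₁ where
  infixl 6 _+_ _-_
  infixl 7 _*_
  field
    Carrier : Set
    _+_ _*_ : Carrier → Carrier → Carrier
    -_ : Carrier → Carrier
    0# 1# : Carrier
    isCommutativeRing : IsCommutativeRing _≡_ _+_ _*_ -_ 0# 1#
    _⁻¹ : Carrier → Carrier
    inverseʳ : ∀ x → x ≢ 0# → x * (x ⁻¹) ≡ 1#
    0≢1 : 0# ≢ 1#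
    _≟_ : (x y : Carrier) → Dec (x ≡ y)
    size : ℕ
    enum : Fin size ↔ Carrier

  _-_ : Carrier → Carrier → Carrier
  x - y = x + (- y)

  fromℕ : ℕ → Carrier
  fromℕ zero = 0#
  fromℕ (suc n) = 1# + fromℕ n

  private
    elt : Fin size → Carrier
    elt = Inverse.to enum

  IsSquare : Carrier → Set
  IsSquare x = ∃ λ y → y * y ≡ x

  isSquare? : ∀ x → Dec (∃ λ (i : Fin size) → elt i * elt i ≡ x)
  isSquare? x = any? (λ i → (elt i * elt i) ≟ x)

  η : Carrier → Carrier
  η x with x ≟ 0#
  ... | yes _ = 0#
  ... | no _ with isSquare? x
  ...   | yes _ = 1#
  ...   | no _ = - 1#

  F : Carrier → Carrier
  F x = (x * x) * (1# + (fromℕ 3 ⁻¹) * η x)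

  C₀₀ : Carrier → Set
  C₀₀ x = η x ≡ 1# × η (x + 1#) ≡ 1#

  C₀₁ : Carrier → Set
  C₀₁ x = η x ≡ 1# × η (x + 1#) ≡ - 1#

  A₀₀ : Carrier → Carrier → Set
  A₀₀ b x = C₀₀ x × F (x + 1#) - F x ≡ b

  A₀₁ : Carrier → Carrier → Set
  A₀₁ b x = C₀₁ x × F (x + 1#) - F x ≡ b

-- Since 3 · 3⁻¹ = 1 we have 3 F(v) = v² (3 + η v), so for x ∈ C₀₀ and y ∈ C₀₁ the equation
-- F(x+1) − F(x) = F(y+1) − F(y), multiplied by 3, reads 4(x+1)² − 4x² = 2(y+1)² − 4y²,
-- i.e. (y−1)² = −4x.  Since x = s² is a nonzero square, −1 = ((y−1)/(2s))² is a square.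
-- Multiplication by a square root i of −1 then permutes the nonzero elements in orbits
-- {w, iw, −w, −iw} of size 4, so q ≡ 1 (mod 4), contradicting q ≡ 3 (mod 4).
module Submission where

open import Algebra.Bundles using (CommutativeRing)
import Algebra.Properties.Group as GroupProperties
import Algebra.Properties.Ring as RingProperties
import Algebra.Solver.Ring.NaturalCoefficients.Default as NaturalCoefficientSolver
open import Data.Bool.Base using (Bool; true; false; _∧_; _∨_; not)
open import Data.Bool.Properties using (∧-identityʳ; ∧-zeroʳ; ∧-conicalˡ)
open import Data.Fin.Base using (Fin; zero; suc)
import Data.Fin.Properties as Fin
open import Data.List.Base using (List; []; _∷_; length)
import Data.List.Membership.DecPropositional as DecMembership
open import Data.List.Relation.Unary.All using ([]; _∷_)
open import Data.List.Relation.Unary.All.Properties using (All¬⇒¬Any)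
open import Data.List.Relation.Unary.Any using (here; there)
open import Data.List.Relation.Unary.Unique.Propositional using (Unique; []; _∷_)
open import Data.Nat.Base as ℕ using (ℕ; zero; suc; _≤_; _<_; _^_; NonZero)
open import Data.Nat.Coprimality using (Coprime; coprime-Bézout; prime⇒coprime)
open import Data.Nat.DivMod using (_%_; [m+kn]%n≡m%n)
open import Data.Nat.Divisibility using (_∣_; divides; _∣0; ∣-refl; ∣m∣n⇒∣m+n)
import Data.Nat.GCD as GCD
open import Data.Nat.Primality using (Prime; prime⇒nonTrivial)
open import Data.Nat.Properties as ℕ using (≤∧≢⇒<; <-trans; n<1+n; n≤0⇒n≡0; m≤n+m; ≤-trans; ≤-refl)
open import Data.Product.Base using (∃; _×_; _,_; proj₁)
open import Defs
open import Function.Base using (_∘_)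
open import Function.Bundles using (_↔_; Inverse; mk⇔)
open import Level using (0ℓ)
open import Relation.Binary.Definitions using (DecidableEquality)
open import Relation.Binary.PropositionalEquality
open import Relation.Nullary using (¬_; Dec; yes; no; does; contradiction)
open import Relation.Nullary.Decidable using (dec-true; dec-false; does-⇔)

countᶠ : ∀ {n} → (Fin n → Bool) → ℕ
countᶠ {zero}  P = 0
countᶠ {suc n} P with P zero
... | true  = suc (countᶠ (P ∘ suc))
... | false = countᶠ (P ∘ suc)

countᶠ-cong : ∀ {n} {P Q : Fin n → Bool} → (∀ i → P i ≡ Q i) → countᶠ P ≡ countᶠ Q
countᶠ-cong {zero}  P≗Q = refl
countᶠ-cong {suc n} {P} {Q} P≗Q with P zero | Q zero | P≗Q zero
... | true  | true  | refl = cong suc (countᶠ-cong (P≗Q ∘ suc))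
... | false | false | refl = countᶠ-cong (P≗Q ∘ suc)

countᶠ-split : ∀ {n} (P Q : Fin n → Bool) →
               countᶠ P ≡ countᶠ (λ i → P i ∧ Q i) ℕ.+ countᶠ (λ i → P i ∧ not (Q i))
countᶠ-split {zero}  P Q = refl
countᶠ-split {suc n} P Q with P zero | Q zero
... | true  | true  = cong suc (countᶠ-split (P ∘ suc) (Q ∘ suc))
... | true  | false = trans (cong suc (countᶠ-split (P ∘ suc) (Q ∘ suc))) (sym (ℕ.+-suc _ _))
... | false | _     = countᶠ-split (P ∘ suc) (Q ∘ suc)

countᶠ≢0⇒∃ : ∀ {n} (P : Fin n → Bool) → countᶠ P ≢ 0 → ∃ λ i → P i ≡ true
countᶠ≢0⇒∃ {zero}  P ≢0 = contradiction refl ≢0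
countᶠ≢0⇒∃ {suc n} P ≢0 with P zero in Pzero
... | true  = zero , Pzero
... | false with countᶠ≢0⇒∃ (P ∘ suc) ≢0
...   | i , Pi = suc i , Pi

countᶠ-true : ∀ n → countᶠ {n} (λ _ → true) ≡ n
countᶠ-true zero    = refl
countᶠ-true (suc n) = cong suc (countᶠ-true n)

countᶠ-false : ∀ n → countᶠ {n} (λ _ → false) ≡ 0
countᶠ-false zero    = refl
countᶠ-false (suc n) = countᶠ-false n

countᶠ-≟ : ∀ {n} (j : Fin n) → countᶠ (λ i → does (i Fin.≟ j)) ≡ 1
countᶠ-≟ {suc n} zero    = cong suc (trans (countᶠ-cong {n} (λ _ → refl)) (countᶠ-false n))
countᶠ-≟ {suc n} (suc j) = trans (countᶠ-cong suc≟suc) (countᶠ-≟ j)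
  where
  suc≟suc : ∀ i → does (suc i Fin.≟ suc j) ≡ does (i Fin.≟ j)
  suc≟suc i = does-⇔ (mk⇔ Fin.suc-injective (cong suc)) (suc i Fin.≟ suc j) (i Fin.≟ j)

module Count {A : Set} (_≟_ : DecidableEquality A) {n : ℕ} (enum : Fin n ↔ A) where
  open Inverse enum using (to; from; strictlyInverseˡ; strictlyInverseʳ)
  open DecMembership _≟_ using (_∈_; _∈?_)

  count : (A → Bool) → ℕ
  count P = countᶠ (P ∘ to)

  count-cong : {P Q : A → Bool} → (∀ w → P w ≡ Q w) → count P ≡ count Q
  count-cong P≗Q = countᶠ-cong (P≗Q ∘ to)

  count-split : (P Q : A → Bool) →
                count P ≡ count (λ w → P w ∧ Q w) ℕ.+ count (λ w → P w ∧ not (Q w))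
  count-split P Q = countᶠ-split (P ∘ to) (Q ∘ to)

  count≢0⇒∃ : (P : A → Bool) → count P ≢ 0 → ∃ λ w → P w ≡ true
  count≢0⇒∃ P ≢0 with countᶠ≢0⇒∃ (P ∘ to) ≢0
  ... | i , Pi = to i , Pi

  count-true : count (λ _ → true) ≡ n
  count-true = countᶠ-true n

  count-≟ : ∀ a → count (λ w → does (w ≟ a)) ≡ 1
  count-≟ a = trans (countᶠ-cong to≟⇔≟from) (countᶠ-≟ (from a))
    where
    to≟⇔≟from : ∀ i → does (to i ≟ a) ≡ does (i Fin.≟ from a)
    to≟⇔≟from i = does-⇔ (mk⇔ (λ toi≡a → trans (sym (strictlyInverseʳ i)) (cong from toi≡a))
                               (λ i≡froma → trans (cong to i≡froma) (strictlyInverseˡ a)))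
                          (to i ≟ a) (i Fin.≟ from a)

  count-∈ : ∀ {xs} → Unique xs → count (λ w → does (w ∈? xs)) ≡ length xs
  count-∈ {[]}     []             = countᶠ-false n
  count-∈ {x ∷ xs} (x∉xs ∷ !xs) = begin
    count (λ w → does (w ∈? x ∷ xs))
      ≡⟨ count-split (λ w → does (w ∈? x ∷ xs)) (λ w → does (w ≟ x)) ⟩
    count (λ w → does (w ∈? x ∷ xs) ∧ does (w ≟ x)) ℕ.+ count (λ w → does (w ∈? x ∷ xs) ∧ not (does (w ≟ x)))
      ≡⟨ cong₂ ℕ._+_ (count-cong at-x) (count-cong off-x) ⟩
    count (λ w → does (w ≟ x)) ℕ.+ count (λ w → does (w ∈? xs))
      ≡⟨ cong₂ ℕ._+_ (count-≟ x) (count-∈ !xs) ⟩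
    suc (length xs) ∎
    where
    open ≡-Reasoning
    -- does (w ∈? x ∷ xs) computes to does (w ≟ x) ∨ does (w ∈? xs).
    at-x : ∀ w → (does (w ≟ x) ∨ does (w ∈? xs)) ∧ does (w ≟ x) ≡ does (w ≟ x)
    at-x w with w ≟ x
    ... | yes _ = refl
    ... | no  _ = ∧-zeroʳ _
    off-x : ∀ w → (does (w ≟ x) ∨ does (w ∈? xs)) ∧ not (does (w ≟ x)) ≡ does (w ∈? xs)
    off-x w with w ≟ x
    ... | yes refl = sym (dec-false (w ∈? xs) (All¬⇒¬Any x∉xs))
    ... | no  _    = ∧-identityʳ _

  module Orbits (σ : A → A) (σ⁴≗id : ∀ w → σ (σ (σ (σ w))) ≡ w) where

    σ-injective : ∀ {v w} → σ v ≡ σ w → v ≡ w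
    σ-injective {v} {w} σv≡σw =
      trans (sym (σ⁴≗id v)) (trans (cong (σ ∘ σ ∘ σ) σv≡σw) (σ⁴≗id w))

    orbit : A → List A
    orbit z = z ∷ σ z ∷ σ (σ z) ∷ σ (σ (σ z)) ∷ []

    orbit-unique : ∀ z → σ (σ z) ≢ z → Unique (orbit z)
    orbit-unique z σ²z≢z =
      (z≢σz ∷ z≢σ²z ∷ z≢σ³z ∷ []) ∷
      (z≢σz ∘ σ-injective ∷ z≢σ²z ∘ σ-injective ∷ []) ∷
      (z≢σz ∘ σ-injective ∘ σ-injective ∷ []) ∷
      [] ∷ []
      where
      z≢σz : z ≢ σ z
      z≢σz z≡σz = σ²z≢z (trans (cong σ (sym z≡σz)) (sym z≡σz))
      z≢σ²z : z ≢ σ (σ z)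
      z≢σ²z = σ²z≢z ∘ sym
      z≢σ³z : z ≢ σ (σ (σ z))
      z≢σ³z z≡σ³z = z≢σz (trans (sym (σ⁴≗id z)) (cong σ (sym z≡σ³z)))

    σ-∈-orbit : ∀ {z w} → w ∈ orbit z → σ w ∈ orbit z
    σ-∈-orbit (here refl)                         = there (here refl)
    σ-∈-orbit (there (here refl))                 = there (there (here refl))
    σ-∈-orbit (there (there (here refl)))         = there (there (there (here refl)))
    σ-∈-orbit {z} (there (there (there (here refl)))) = here (σ⁴≗id z)

    σ⁻¹-∈-orbit : ∀ {z w} → σ w ∈ orbit z → w ∈ orbit z
    σ⁻¹-∈-orbit {z} {w} σw∈ = subst (_∈ orbit z) (σ⁴≗id w) (σ-∈-orbit (σ-∈-orbit (σ-∈-orbit σw∈)))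

    σ-Invariant : (A → Bool) → Set
    σ-Invariant P = ∀ w → P (σ w) ≡ P w

    σ²-FixedPointFree : (A → Bool) → Set
    σ²-FixedPointFree P = ∀ w → P w ≡ true → σ (σ w) ≢ w

    orbit-invariant : ∀ z → σ-Invariant (λ w → does (w ∈? orbit z))
    orbit-invariant z w = does-⇔ (mk⇔ σ⁻¹-∈-orbit σ-∈-orbit) (σ w ∈? orbit z) (w ∈? orbit z)

    invariant-on-orbit : ∀ {P} → σ-Invariant P → ∀ {z w} → w ∈ orbit z → P w ≡ P z
    invariant-on-orbit inv     (here refl)                 = refl
    invariant-on-orbit inv {z} (there (here refl))         = inv z
    invariant-on-orbit inv {z} (there (there (here refl))) = trans (inv (σ z)) (inv z)
    invariant-on-orbit inv {z} (there (there (there (here refl)))) =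
      trans (inv (σ (σ z))) (trans (inv (σ z)) (inv z))

    _∖orbit_ : (A → Bool) → A → A → Bool
    (P ∖orbit z) w = P w ∧ not (does (w ∈? orbit z))

    count-remove-orbit : ∀ {P z} → σ-Invariant P → P z ≡ true → σ (σ z) ≢ z →
                         count P ≡ 4 ℕ.+ count (P ∖orbit z)
    count-remove-orbit {P} {z} inv Pz σ²z≢z = begin
      count P
        ≡⟨ count-split P (λ w → does (w ∈? orbit z)) ⟩
      count (λ w → P w ∧ does (w ∈? orbit z)) ℕ.+ count (P ∖orbit z)
        ≡⟨ cong (ℕ._+ count (P ∖orbit z)) (count-cong on-orbit) ⟩
      count (λ w → does (w ∈? orbit z)) ℕ.+ count (P ∖orbit z)
        ≡⟨ cong (ℕ._+ count (P ∖orbit z)) (count-∈ (orbit-unique z σ²z≢z)) ⟩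
      4 ℕ.+ count (P ∖orbit z) ∎
      where
      open ≡-Reasoning
      on-orbit : ∀ w → P w ∧ does (w ∈? orbit z) ≡ does (w ∈? orbit z)
      on-orbit w = decided (w ∈? orbit z)
        where
        decided : (w∈? : Dec (w ∈ orbit z)) → P w ∧ does w∈? ≡ does w∈?
        decided (yes w∈) = trans (∧-identityʳ (P w)) (trans (invariant-on-orbit inv w∈) Pz)
        decided (no  _)  = ∧-zeroʳ (P w)

    4∣count : ∀ P → σ-Invariant P → σ²-FixedPointFree P → 4 ∣ count P
    4∣count P = bounded (count P) P ≤-refl
      where
      bounded : ∀ k P → count P ≤ k → σ-Invariant P → σ²-FixedPointFree P → 4 ∣ count P
      bounded k P bound inv free with count P ℕ.≟ 0
      ... | yes ≡0 = subst (4 ∣_) (sym ≡0) (4 ∣0)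
      ... | no  ≢0 with k | count≢0⇒∃ P ≢0
      ...   | zero  | _      = contradiction (n≤0⇒n≡0 bound) ≢0
      ...   | suc k | z , Pz =
        subst (4 ∣_) (sym removal) (∣m∣n⇒∣m+n ∣-refl (bounded k (P ∖orbit z) bound′ inv′ free′))
        where
        removal : count P ≡ 4 ℕ.+ count (P ∖orbit z)
        removal = count-remove-orbit inv Pz (free z Pz)
        bound′ : count (P ∖orbit z) ≤ k
        bound′ = ≤-trans (m≤n+m (count (P ∖orbit z)) 3) (ℕ.≤-pred (subst (_≤ suc k) removal bound))
        inv′ : σ-Invariant (P ∖orbit z)
        inv′ w = cong₂ (λ a b → a ∧ not b) (inv w) (orbit-invariant z w)
        free′ : σ²-FixedPointFree (P ∖orbit z)
        free′ w w∈P∖orbit = free w (∧-conicalˡ (P w) _ w∈P∖orbit)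

prime≢2,3⇒3<p : ∀ {p} → Prime p → p ≢ 2 → p ≢ 3 → 3 < p
prime≢2,3⇒3<p {p} p-prime p≢2 p≢3 =
  ≤∧≢⇒< (≤∧≢⇒< (ℕ.nonTrivial⇒n>1 p {{prime⇒nonTrivial p-prime}}) (p≢2 ∘ sym)) (p≢3 ∘ sym)

module FiniteFieldProperties (K : FiniteField) where
  open FiniteField K

  commutativeRing : CommutativeRing 0ℓ 0ℓ
  commutativeRing = record { isCommutativeRing = isCommutativeRing }

  open CommutativeRing commutativeRing
    using (+-assoc; +-comm; +-identityˡ; +-identityʳ; -‿inverseˡ; -‿inverseʳ;
           *-assoc; *-comm; *-identityˡ; *-identityʳ; distribˡ; distribʳ; zeroˡ; zeroʳ;
           ring; +-group; commutativeSemiring)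
  open RingProperties ring using (-‿distribˡ-*; -1*x≈-x)
  open GroupProperties +-group using (inverseˡ-unique; ⁻¹-involutive; ε⁻¹≈ε; ∙-cancelʳ)
  open NaturalCoefficientSolver commutativeSemiring using (solve; _:=_; _:+_; _:*_; con; Polynomial)

  x⁻¹*x≡1 : ∀ {x} → x ≢ 0# → x ⁻¹ * x ≡ 1#
  x⁻¹*x≡1 {x} x≢0 = trans (*-comm (x ⁻¹) x) (inverseʳ x x≢0)

  x*y≡0⇒y≡0 : ∀ {x y} → x ≢ 0# → x * y ≡ 0# → y ≡ 0#
  x*y≡0⇒y≡0 {x} {y} x≢0 xy≡0 = begin
    y              ≡⟨ sym (*-identityˡ y) ⟩
    1# * y         ≡⟨ cong (_* y) (sym (x⁻¹*x≡1 x≢0)) ⟩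
    x ⁻¹ * x * y   ≡⟨ *-assoc (x ⁻¹) x y ⟩
    x ⁻¹ * (x * y) ≡⟨ cong (x ⁻¹ *_) xy≡0 ⟩
    x ⁻¹ * 0#      ≡⟨ zeroʳ (x ⁻¹) ⟩
    0#             ∎
    where open ≡-Reasoning

  -1≢0 : - 1# ≢ 0#
  -1≢0 -1≡0 = 0≢1 (trans (sym ε⁻¹≈ε) (trans (cong -_ (sym -1≡0)) (⁻¹-involutive 1#)))

  x*y≢0 : ∀ {x y} → x ≢ 0# → y ≢ 0# → x * y ≢ 0#
  x*y≢0 x≢0 y≢0 = y≢0 ∘ x*y≡0⇒y≡0 x≢0

  x+y≡y⇒x≡0 : ∀ {x y} → x + y ≡ y → x ≡ 0#
  x+y≡y⇒x≡0 {x} {y} x+y≡y = ∙-cancelʳ y x 0# (trans x+y≡y (sym (+-identityˡ y)))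

  x-y+y≡x : ∀ x y → x - y + y ≡ x
  x-y+y≡x x y = trans (+-assoc x (- y) y) (trans (cong (x +_) (-‿inverseˡ y)) (+-identityʳ x))

  x+y-y≡x : ∀ x y → x + y - y ≡ x
  x+y-y≡x x y = trans (+-assoc x y (- y)) (trans (cong (x +_) (-‿inverseʳ y)) (+-identityʳ x))

  x-y≡z-w⇒x+w≡z+y : ∀ {x y z w} → x - y ≡ z - w → x + w ≡ z + y
  x-y≡z-w⇒x+w≡z+y {x} {y} {z} {w} x-y≡z-w = begin
    x + w             ≡⟨ cong (_+ w) (sym (x-y+y≡x x y)) ⟩
    x - y + y + w     ≡⟨ cong (λ v → v + y + w) x-y≡z-w ⟩
    z - w + y + w     ≡⟨ swap (z - w) y w ⟩
    z - w + w + y     ≡⟨ cong (_+ y) (x-y+y≡x z w) ⟩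
    z + y             ∎
    where
    open ≡-Reasoning
    swap : ∀ a b c → a + b + c ≡ a + c + b
    swap = solve 3 (λ a b c → a :+ b :+ c := a :+ c :+ b) refl

  fromℕ-+ : ∀ m n → fromℕ (m ℕ.+ n) ≡ fromℕ m + fromℕ n
  fromℕ-+ zero    n = sym (+-identityˡ (fromℕ n))
  fromℕ-+ (suc m) n = trans (cong (1# +_) (fromℕ-+ m n)) (sym (+-assoc 1# (fromℕ m) (fromℕ n)))

  fromℕ-* : ∀ m n → fromℕ (m ℕ.* n) ≡ fromℕ m * fromℕ n
  fromℕ-* zero    n = sym (zeroˡ (fromℕ n))
  fromℕ-* (suc m) n = begin
    fromℕ (n ℕ.+ m ℕ.* n)          ≡⟨ fromℕ-+ n (m ℕ.* n) ⟩
    fromℕ n + fromℕ (m ℕ.* n)      ≡⟨ cong₂ _+_ (sym (*-identityˡ (fromℕ n))) (fromℕ-* m n) ⟩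
    1# * fromℕ n + fromℕ m * fromℕ n ≡⟨ sym (distribʳ (fromℕ n) 1# (fromℕ m)) ⟩
    (1# + fromℕ m) * fromℕ n       ∎
    where open ≡-Reasoning

  -- ⟦ num n ⟧ reduces to fromℕ n, so solver numerals coincide with the field's.
  num : ∀ {m} → ℕ → Polynomial m
  num zero    = con 0
  num (suc n) = con 1 :+ num n

  x+x≡2*x : ∀ x → x + x ≡ fromℕ 2 * x
  x+x≡2*x = solve 1 (λ x → x :+ x := num 2 :* x) refl

  fromℕ≡0⇒fromℕ-suc≢0 : ∀ n → fromℕ n ≡ 0# → fromℕ (suc n) ≢ 0#
  fromℕ≡0⇒fromℕ-suc≢0 n n≡0 1+n≡0 = 0≢1 (begin
    0#             ≡⟨ sym 1+n≡0 ⟩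
    1# + fromℕ n   ≡⟨ cong (1# +_) n≡0 ⟩
    1# + 0#        ≡⟨ +-identityʳ 1# ⟩
    1#             ∎)
    where open ≡-Reasoning

  fromℕ-*-≡0 : ∀ m n → fromℕ n ≡ 0# → fromℕ (m ℕ.* n) ≡ 0#
  fromℕ-*-≡0 m n n≡0 = trans (fromℕ-* m n) (trans (cong (fromℕ m *_) n≡0) (zeroʳ (fromℕ m)))

  coprime⇒fromℕ≢0 : ∀ {m n} → fromℕ m ≡ 0# → Coprime m n → fromℕ n ≢ 0#
  coprime⇒fromℕ≢0 {m} {n} m≡0 coprime n≡0 with coprime-Bézout coprime
  ... | GCD.Bézout.+- x y 1+yn≡xm =
    fromℕ≡0⇒fromℕ-suc≢0 (y ℕ.* n) (fromℕ-*-≡0 y n n≡0)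
      (trans (cong fromℕ 1+yn≡xm) (fromℕ-*-≡0 x m m≡0))
  ... | GCD.Bézout.-+ x y 1+xm≡yn =
    fromℕ≡0⇒fromℕ-suc≢0 (x ℕ.* m) (fromℕ-*-≡0 x m m≡0)
      (trans (cong fromℕ 1+xm≡yn) (fromℕ-*-≡0 y n n≡0))

  prime⇒fromℕ≢0 : ∀ {p d} .{{_ : NonZero d}} → Prime p → fromℕ p ≡ 0# → d < p → fromℕ d ≢ 0#
  prime⇒fromℕ≢0 p-prime p≡0 d<p = coprime⇒fromℕ≢0 p≡0 (prime⇒coprime p-prime d<p)

  square-ratio : ∀ {a c} → c ≢ 0# → a * a ≡ - (c * c) → IsSquare (- 1#)
  square-ratio {a} {c} c≢0 a²≡-c² = a * c ⁻¹ , (begin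
    a * c ⁻¹ * (a * c ⁻¹)        ≡⟨ regroup a (c ⁻¹) ⟩
    a * a * (c ⁻¹ * c ⁻¹)        ≡⟨ cong (_* (c ⁻¹ * c ⁻¹)) a²≡-c² ⟩
    - (c * c) * (c ⁻¹ * c ⁻¹)    ≡⟨ sym (-‿distribˡ-* (c * c) (c ⁻¹ * c ⁻¹)) ⟩
    - (c * c * (c ⁻¹ * c ⁻¹))    ≡⟨ cong -_ (sym (regroup c (c ⁻¹))) ⟩
    - (c * c ⁻¹ * (c * c ⁻¹))    ≡⟨ cong -_ (cong₂ _*_ (inverseʳ c c≢0) (inverseʳ c c≢0)) ⟩
    - (1# * 1#)                  ≡⟨ cong -_ (*-identityˡ 1#) ⟩
    - 1#                         ∎)
    where
    open ≡-Reasoning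
    regroup : ∀ x y → x * y * (x * y) ≡ x * x * (y * y)
    regroup = solve 2 (λ x y → x :* y :* (x :* y) := x :* x :* (y :* y)) refl

  open Count _≟_ enum

  nonzero : Carrier → Bool
  nonzero w = not (does (w ≟ 0#))

  nonzero≡true⇒≢0 : ∀ {w} → nonzero w ≡ true → w ≢ 0#
  nonzero≡true⇒≢0 {w} nonzero-w w≡0 with () ← trans (sym (cong not (dec-true (w ≟ 0#) w≡0))) nonzero-w

  size≡1+count-nonzero : size ≡ 1 ℕ.+ count nonzero
  size≡1+count-nonzero = begin
    size                                             ≡⟨ sym count-true ⟩
    count (λ _ → true)                               ≡⟨ count-split (λ _ → true) (λ w → does (w ≟ 0#)) ⟩
    count (λ w → does (w ≟ 0#)) ℕ.+ count nonzero   ≡⟨ cong (ℕ._+ count nonzero) (count-≟ 0#) ⟩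
    1 ℕ.+ count nonzero                              ∎
    where open ≡-Reasoning

  module OddCharacteristic (2≢0 : fromℕ 2 ≢ 0#) where

    -1≢1 : - 1# ≢ 1#
    -1≢1 -1≡1 = 2≢0 (begin
      1# + (1# + 0#) ≡⟨ cong (1# +_) (+-identityʳ 1#) ⟩
      1# + 1#        ≡⟨ cong (1# +_) (sym -1≡1) ⟩
      1# + - 1#      ≡⟨ -‿inverseʳ 1# ⟩
      0#             ∎)
      where open ≡-Reasoning

    -x≡x⇒x≡0 : ∀ {x} → - x ≡ x → x ≡ 0#
    -x≡x⇒x≡0 {x} -x≡x =
      x*y≡0⇒y≡0 2≢0 (trans (sym (x+x≡2*x x)) (trans (cong (_+ x) (sym -x≡x)) (-‿inverseˡ x)))

    η≡1⇒nonzero-square : ∀ {x} → η x ≡ 1# → x ≢ 0# × IsSquare x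
    η≡1⇒nonzero-square {x} ηx≡1 with x ≟ 0#
    ... | yes _ = contradiction ηx≡1 0≢1
    ... | no x≢0 with isSquare? x
    ...   | yes (_ , s²≡x) = x≢0 , (_ , s²≡x)
    ...   | no  _          = contradiction ηx≡1 -1≢1

    -1-isSquare⇒4∣count-nonzero : IsSquare (- 1#) → 4 ∣ count nonzero
    -1-isSquare⇒4∣count-nonzero (i , i²≡-1) = 4∣count nonzero nonzero-invariant nonzero-free
      where
      σ : Carrier → Carrier
      σ w = i * w
      σ²≡- : ∀ w → σ (σ w) ≡ - w
      σ²≡- w = trans (sym (*-assoc i i w)) (trans (cong (_* w) i²≡-1) (-1*x≈-x w))
      σ⁴≗id : ∀ w → σ (σ (σ (σ w))) ≡ w
      σ⁴≗id w = trans (σ²≡- (σ (σ w))) (trans (cong -_ (σ²≡- w)) (⁻¹-involutive w))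
      open Orbits σ σ⁴≗id
      i≢0 : i ≢ 0#
      i≢0 i≡0 = -1≢0 (trans (sym i²≡-1) (trans (cong (_* i) i≡0) (zeroˡ i)))
      nonzero-invariant : σ-Invariant nonzero
      nonzero-invariant w = cong not (does-⇔ (mk⇔ (x*y≡0⇒y≡0 i≢0) (λ w≡0 → trans (cong (i *_) w≡0) (zeroʳ i)))
                                             (σ w ≟ 0#) (w ≟ 0#))
      nonzero-free : σ²-FixedPointFree nonzero
      nonzero-free w nonzero-w σ²w≡w =
        nonzero≡true⇒≢0 nonzero-w (-x≡x⇒x≡0 (trans (sym (σ²≡- w)) σ²w≡w))

    -1-isSquare⇒size%4≡1 : IsSquare (- 1#) → size % 4 ≡ 1
    -1-isSquare⇒size%4≡1 -1-isSquare with -1-isSquare⇒4∣count-nonzero -1-isSquare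
    ... | divides k count≡k*4 = begin
      size % 4              ≡⟨ cong (_% 4) size≡1+count-nonzero ⟩
      (1 ℕ.+ count nonzero) % 4 ≡⟨ cong (λ c → (1 ℕ.+ c) % 4) count≡k*4 ⟩
      (1 ℕ.+ k ℕ.* 4) % 4   ≡⟨ [m+kn]%n≡m%n 1 k 4 ⟩
      1                     ∎
      where open ≡-Reasoning

    shifted-squares : ∀ x u →
      (x + 1#) * (x + 1#) * fromℕ 4 + (u + 1#) * (u + 1#) * fromℕ 4 ≡
        (u + 1# + 1#) * (u + 1# + 1#) * fromℕ 2 + x * x * fromℕ 4 →
      u * u + fromℕ 4 * x ≡ 0#
    shifted-squares x u balanced =
      x*y≡0⇒y≡0 2≢0 (x+y≡y⇒x≡0 (trans (sym (expand x u)) balanced))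
      where
      expand : ∀ x u → (x + 1#) * (x + 1#) * fromℕ 4 + (u + 1#) * (u + 1#) * fromℕ 4 ≡
                 fromℕ 2 * (u * u + fromℕ 4 * x) +
                   ((u + 1# + 1#) * (u + 1# + 1#) * fromℕ 2 + x * x * fromℕ 4)
      expand = solve 2 (λ x u →
        (x :+ con 1) :* (x :+ con 1) :* num 4 :+ (u :+ con 1) :* (u :+ con 1) :* num 4 :=
        num 2 :* (u :* u :+ num 4 :* x) :+
          ((u :+ con 1 :+ con 1) :* (u :+ con 1 :+ con 1) :* num 2 :+ x :* x :* num 4)) refl

    module CharacteristicAbove3 (3≢0 : fromℕ 3 ≢ 0#) where

      3*F≡ : ∀ v → fromℕ 3 * F v ≡ v * v * (fromℕ 3 + η v)
      3*F≡ v = begin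
        fromℕ 3 * (v * v * (1# + fromℕ 3 ⁻¹ * η v))     ≡⟨ distribute (v * v) (fromℕ 3 ⁻¹) (η v) ⟩
        v * v * (fromℕ 3 + fromℕ 3 * fromℕ 3 ⁻¹ * η v)  ≡⟨ cong (λ c → v * v * (fromℕ 3 + c * η v))
                                                                (inverseʳ (fromℕ 3) 3≢0) ⟩
        v * v * (fromℕ 3 + 1# * η v)                    ≡⟨ cong (λ c → v * v * (fromℕ 3 + c)) (*-identityˡ (η v)) ⟩
        v * v * (fromℕ 3 + η v)                         ∎
        where
        open ≡-Reasoning
        distribute : ∀ a t e → fromℕ 3 * (a * (1# + t * e)) ≡ a * (fromℕ 3 + fromℕ 3 * t * e)
        distribute = solve 3 (λ a t e → num 3 :* (a :* (con 1 :+ t :* e)) := a :* (num 3 :+ num 3 :* t :* e)) refl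

      3*F≡4*square : ∀ {v} → η v ≡ 1# → fromℕ 3 * F v ≡ v * v * fromℕ 4
      3*F≡4*square {v} ηv≡1 =
        trans (3*F≡ v) (cong (λ e → v * v * e) (trans (cong (fromℕ 3 +_) ηv≡1) (+-comm (fromℕ 3) 1#)))

      3*F≡2*square : ∀ {v} → η v ≡ - 1# → fromℕ 3 * F v ≡ v * v * fromℕ 2
      3*F≡2*square {v} ηv≡-1 =
        trans (3*F≡ v) (cong (λ e → v * v * e)
          (trans (cong (fromℕ 3 +_) ηv≡-1)
                 (trans (cong (_- 1#) (+-comm 1# (fromℕ 2))) (x+y-y≡x (fromℕ 2) 1#))))

      A₀₀-A₀₁-relation : ∀ {b x y} → A₀₀ b x → A₀₁ b y → (y - 1#) * (y - 1#) + fromℕ 4 * x ≡ 0#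
      A₀₀-A₀₁-relation {b} {x} {y} ((ηx≡1 , ηx+1≡1) , Δx≡b) ((ηy≡1 , ηy+1≡-1) , Δy≡b) =
        shifted-squares x (y - 1#) (subst Balanced (sym (x-y+y≡x y 1#)) balanced)
        where
        Balanced : Carrier → Set
        Balanced v = (x + 1#) * (x + 1#) * fromℕ 4 + v * v * fromℕ 4 ≡
                     (v + 1#) * (v + 1#) * fromℕ 2 + x * x * fromℕ 4
        balanced : Balanced y
        balanced = begin
          (x + 1#) * (x + 1#) * fromℕ 4 + y * y * fromℕ 4
            ≡⟨ sym (cong₂ _+_ (3*F≡4*square ηx+1≡1) (3*F≡4*square ηy≡1)) ⟩
          fromℕ 3 * F (x + 1#) + fromℕ 3 * F y
            ≡⟨ sym (distribˡ (fromℕ 3) (F (x + 1#)) (F y)) ⟩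
          fromℕ 3 * (F (x + 1#) + F y)
            ≡⟨ cong (fromℕ 3 *_) (x-y≡z-w⇒x+w≡z+y (trans Δx≡b (sym Δy≡b))) ⟩
          fromℕ 3 * (F (y + 1#) + F x)
            ≡⟨ distribˡ (fromℕ 3) (F (y + 1#)) (F x) ⟩
          fromℕ 3 * F (y + 1#) + fromℕ 3 * F x
            ≡⟨ cong₂ _+_ (3*F≡2*square ηy+1≡-1) (3*F≡4*square ηx≡1) ⟩
          (y + 1#) * (y + 1#) * fromℕ 2 + x * x * fromℕ 4 ∎
          where open ≡-Reasoning

      A₀₀-A₀₁⇒-1-isSquare : ∀ {b x y} → A₀₀ b x → A₀₁ b y → IsSquare (- 1#)
      A₀₀-A₀₁⇒-1-isSquare {b} {x} {y} x∈A₀₀ y∈A₀₁ with η≡1⇒nonzero-square (proj₁ (proj₁ x∈A₀₀))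
      ... | x≢0 , s , s²≡x = square-ratio 2s≢0 (inverseˡ-unique (u * u) (fromℕ 2 * s * (fromℕ 2 * s)) (begin
        u * u + fromℕ 2 * s * (fromℕ 2 * s) ≡⟨ cong (u * u +_) (four-squares s) ⟩
        u * u + fromℕ 4 * (s * s)           ≡⟨ cong (λ v → u * u + fromℕ 4 * v) s²≡x ⟩
        u * u + fromℕ 4 * x                 ≡⟨ A₀₀-A₀₁-relation x∈A₀₀ y∈A₀₁ ⟩
        0#                                  ∎))
        where
        open ≡-Reasoning
        u : Carrier
        u = y - 1#
        s≢0 : s ≢ 0#
        s≢0 s≡0 = x≢0 (trans (sym s²≡x) (trans (cong (_* s) s≡0) (zeroˡ s)))
        2s≢0 : fromℕ 2 * s ≢ 0#
        2s≢0 = x*y≢0 2≢0 s≢0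
        four-squares : ∀ s → fromℕ 2 * s * (fromℕ 2 * s) ≡ fromℕ 4 * (s * s)
        four-squares = solve 1 (λ s → num 2 :* s :* (num 2 :* s) := num 4 :* (s :* s)) refl

lemma17 : (K : FiniteField) → let open FiniteField K in
    (p n : ℕ) → Prime p → p ≢ 2 → p ≢ 3 → fromℕ p ≡ 0# →
    size ≡ p ^ n → size % 4 ≡ 3 →
    (b : Carrier) → ¬ ((∃ λ x → A₀₀ b x) × (∃ λ y → A₀₁ b y))
-- Only p ≠ 2, 3 matters (it makes 2 and 3 invertible).
lemma17 K p _ p-prime p≢2 p≢3 p≡0 _ size%4≡3 _ ((_ , x∈A₀₀) , (_ , y∈A₀₁)) =
  1≢3 (trans (sym (-1-isSquare⇒size%4≡1 (A₀₀-A₀₁⇒-1-isSquare x∈A₀₀ y∈A₀₁))) size%4≡3)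
  where
  open FiniteFieldProperties K
  3<p : 3 < p
  3<p = prime≢2,3⇒3<p p-prime p≢2 p≢3
  open OddCharacteristic (prime⇒fromℕ≢0 p-prime p≡0 (<-trans (n<1+n 2) 3<p))
  open CharacteristicAbove3 (prime⇒fromℕ≢0 p-prime p≡0 3<p)
  1≢3 : 1 ≢ 3
  1≢3 ()
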